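{- Let $G=(V,E)$ be an event graph and let $\mathcal C$ be the unique sink component of $\mathrm{dec}(G)$ that is reachable from every node of the form $(w,\emptyset)$, $w\in V$. Let $v\in V$ and $X\subseteq\mathcal U_{|V}$. Then $(v,X)\in\mathcal C$ if and only if there exists a closed walk $W$ in $G$ such that: (1) $W$ starts and ends at $v$; (2) for each $x\in\mathcal U_{|V}$, at least one node of $W$ has label $\texttt{i}x$ or $\texttt{d}x$; (3) for each $x\in\mathcal U_{|V}$, $x\in X$ if and only if the last node of $W$ whose label refers to $x$ is labeled $\texttt{i}x$, and $x\notin X$ if and only if that last node is labeled $\texttt{d}x$.
   Context: An event graph is a finite, connected, undirected graph $G=(V,E)$ in which every node $v$ carries a label of the form $\texttt{i}x_v$ (insert) or $\texttt{d}x_v$ (delete), where $x_v$ is an element of a finite universe $\mathcal U$. Let $\mathcal U_{|V}=\{x_v : v\in V\}$. It is assumed that for every $x\in\mathcal U_{|V}$ there is at least one node labeled $\texttt{i}x$ and at least one node labeled $\texttt{d}x$. The decorated graph $\mathrm{dec}(G)$ is the directed graph with vertex set $V\times 2^{\mathcal U_{|V}}$, in which $((u,X),(v,Y))$ is an edge iff $\{u,v\}\in E$ and $Y=X\cup\{x_v\}$ if $v$ is labeled $\texttt{i}x_v$, resp. $Y=X\setminus\{x_v\}$ if $v$ is labeled $\texttt{d}x_v$. A sink component is a strongly connected component with no edges leaving it. A walk is a finite sequence of nodes in which consecutive nodes are adjacent (nodes may repeat). -}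

module Defs where

open import Data.Nat using (ℕ)
open import Data.Fin using (Fin)
open import Data.Fin.Subset using (Subset; _∈_; _∉_; _∪_; ⁅_⁆; _-_) renaming (⊥ to ∅)
open import Data.Bool using (Bool; true)
open import Data.Maybe using (just)
open import Data.List using (List; []; _∷_; _++_; head; last)
open import Data.List.Relation.Unary.All using (All)
open import Data.List.Relation.Unary.Any using (Any)
open import Data.List.Relation.Unary.Linked using (Linked)
open import Data.Product using (Σ; ∃; ∃-syntax; _×_; _,_)
open import Relation.Binary.PropositionalEquality using (_≡_; _≢_)
open import Relation.Binary.Construct.Closure.ReflexiveTransitive using (Star)
open import Function.Bundles using (_⇔_)
open import Relation.Nullary using (¬_)

data Op : Set where
  ins del : Op

module _ {n : ℕ} (adj : Fin n → Fin n → Bool) where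
  Adj : Fin n → Fin n → Set
  Adj u v = adj u v ≡ true

  IsWalk : List (Fin n) → Set
  IsWalk = Linked Adj

  WalkFromTo : Fin n → Fin n → List (Fin n) → Set
  WalkFromTo u v W = IsWalk W × head W ≡ just u × last W ≡ just v

-- An event graph on vertex set V = Fin n, over the finite universe U = Fin m.
-- Node v is labelled (op v) (elem v), i.e. i x_v or d x_v with x_v = elem v.
record EventGraph (n m : ℕ) : Set where
  field
    adj       : Fin n → Fin n → Bool
    symmetric : ∀ u v → adj u v ≡ adj v u
    loopless  : ∀ v → adj v v ≢ true
    connected : ∀ u v → ∃[ W ] WalkFromTo adj u v W
    op        : Fin n → Op
    elem      : Fin n → Fin m
    hasIns    : ∀ v → ∃[ u ] (elem u ≡ elem v × op u ≡ ins)
    hasDel    : ∀ v → ∃[ u ] (elem u ≡ elem v × op u ≡ del)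

module EG {n m : ℕ} (G : EventGraph n m) where
  open EventGraph G public

  Edge : Fin n → Fin n → Set
  Edge = Adj adj

  InU : Fin m → Set
  InU x = ∃[ v ] elem v ≡ x

  SubU : Subset m → Set
  SubU X = ∀ x → x ∈ X → InU x

  DNode : Set
  DNode = Fin n × Subset m

  ValidD : DNode → Set
  ValidD (v , X) = SubU X

  step : Fin n → Subset m → Subset m
  step v X with op v
  ... | ins = X ∪ ⁅ elem v ⁆
  ... | del = X - elem v

  DEdge : DNode → DNode → Set
  DEdge (u , X) (v , Y) = ValidD (u , X) × ValidD (v , Y) × Edge u v × Y ≡ step v X

  Reach : DNode → DNode → Set
  Reach = Star DEdge

  IsSinkComponent : (DNode → Set) → Set
  IsSinkComponent C =
      (∀ p → C p → ValidD p)
    × (∃[ p ] C p)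
    × (∀ p q → C p → C q → Reach p q)
    × (∀ p q → C p → Reach p q → Reach q p → C q)
    × (∀ p q → C p → DEdge p q → C q)

  ReachableFromAllEmpty : (DNode → Set) → Set
  ReachableFromAllEmpty C = ∀ w → ∃[ p ] (C p × Reach (w , ∅) p)

  LastRefIs : List (Fin n) → Fin m → Op → Set
  LastRefIs W x o =
    ∃[ A ] ∃[ u ] ∃[ B ]
      (W ≡ A ++ (u ∷ B) × elem u ≡ x × op u ≡ o × All (λ w → elem w ≢ x) B)

  GoodClosedWalk : Fin n → Subset m → List (Fin n) → Set
  GoodClosedWalk v X W =
      WalkFromTo adj v v W
    × (∀ x → InU x → Any (λ u → elem u ≡ x) W)
    × (∀ x → InU x → (x ∈ X ⇔ LastRefIs W x ins) × (x ∉ X ⇔ LastRefIs W x del))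

module Submission where

-- Walking in dec(G) from (u , Y) along a walk of G ends in the set obtained from
-- Y by performing the walk's operations in order, so an element referred to by
-- the walk is in the final set iff its last reference is an insertion. If
-- (v , X) lies in a sink component, a tour from v through every node followed by
-- a path in the component back to (v , X) is therefore a good closed walk.
-- Conversely, from any node of the component, entering v from a neighbour and
-- then following a good closed walk at v must end exactly in (v , X).

open import Defs
open import Data.Fin using (Fin; zero; suc; _≟_)
open import Data.Fin.Subset using (Subset; _∈_; _∉_; _∪_; ⁅_⁆; _-_)
open import Data.Fin.Subset.Properties
  using (⊆-antisym; p⊆p∪q; q⊆p∪q; x∈p∪q⁻; x∈⁅x⁆; x≢y⇒x∉⁅y⁆; p─q⊆p; x∈p∧x≢y⇒x∈p-y)
open import Data.List using (List; []; _∷_; _++_; last; foldl; allFin)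
open import Data.List.Properties using (foldl-++)
open import Data.List.Relation.Unary.All using (All; []; _∷_)
open import Data.List.Relation.Unary.All.Properties using (All¬⇒¬Any; ¬Any⇒All¬)
open import Data.List.Relation.Unary.Any using (Any; here; there; any?)
import Data.List.Relation.Unary.Any as Any
open import Data.List.Relation.Unary.Linked using (Linked; [-]; _∷_)
open import Data.List.Membership.Propositional using () renaming (_∈_ to _∈ₗ_)
open import Data.List.Membership.Propositional.Properties using (∈-allFin; ∈-++⁺ˡ)
open import Data.List.Relation.Binary.Subset.Propositional using () renaming (_⊆_ to _⊆ₗ_)
open import Data.List.Relation.Binary.Subset.Propositional.Properties using (xs⊆xs++ys; xs⊆ys++xs)
open import Data.Maybe using (just)
open import Data.Vec using (_∷_; there)
open import Data.Product using (Σ; ∃-syntax; _×_; _,_; proj₁; proj₂; map₂)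
open import Data.Sum using ([_,_]′)
open import Function using (_∘_; id; flip)
open import Function.Bundles using (_⇔_; mk⇔; Equivalence)
open import Function.Construct.Composition using (_⇔-∘_)
open import Function.Construct.Symmetry using (⇔-sym)
open import Relation.Binary.Core using (Rel)
open import Relation.Binary.PropositionalEquality using (_≡_; _≢_; refl; sym; trans; cong; subst)
open import Relation.Binary.Construct.Closure.ReflexiveTransitive using (Star; ε; _◅_; _◅◅_)
open import Relation.Nullary using (yes; no; contradiction)

open Equivalence using (to; from)

x∉p-x : ∀ {k} (p : Subset k) x → x ∉ p - x
x∉p-x (_ ∷ p) zero    ()
x∉p-x (_ ∷ p) (suc x) (there x∈p-x) = x∉p-x p x x∈p-x

ins≢del : ins ≢ del
ins≢del ()

module _ {a r} {A : Set a} {R : Rel A r} where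

  trail : ∀ {x y} → Star R x y → List A
  trail ε                 = []
  trail (_◅_ {j = y} _ p) = y ∷ trail p

  trail-◅◅ : ∀ {x y z} (p : Star R x y) (q : Star R y z) → trail (p ◅◅ q) ≡ trail p ++ trail q
  trail-◅◅ ε       q = refl
  trail-◅◅ (_ ◅ p) q = cong (_ ∷_) (trail-◅◅ p q)

  end∈trail : ∀ {x y} (p : Star R x y) → y ∈ₗ x ∷ trail p
  end∈trail ε       = here refl
  end∈trail (_ ◅ p) = there (end∈trail p)

  Star⇒Linked : ∀ {x y} (p : Star R x y) → Linked R (x ∷ trail p) × last (x ∷ trail p) ≡ just y
  Star⇒Linked ε = [-] , refl
  Star⇒Linked (e ◅ p) with Star⇒Linked p
  ... | linked , end = e ∷ linked , end

  Linked⇒Star : ∀ {x y} T → Linked R (x ∷ T) → last (x ∷ T) ≡ just y →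
                Σ (Star R x y) λ p → trail p ≡ T
  Linked⇒Star []      [-]          refl = ε , refl
  Linked⇒Star (_ ∷ T) (e ∷ linked) end with Linked⇒Star T linked end
  ... | p , refl = e ◅ p , refl

  Star-preserves : ∀ {ℓ} {P : A → Set ℓ} → (∀ {x y} → R x y → P x → P y) →
                   ∀ {x y} → Star R x y → P x → P y
  Star-preserves preserve ε       = id
  Star-preserves preserve (e ◅ p) = Star-preserves preserve p ∘ preserve e

module _ {n m} (G : EventGraph n m) where
  open EG G

  Path : Fin n → Fin n → Set
  Path = Star Edge

  Edge-sym : ∀ {u v} → Edge u v → Edge v u
  Edge-sym {u} {v} e = trans (symmetric v u) e

  path : ∀ u v → Path u v
  path u v with connected u v
  ... | []      , _      , ()   , _
  ... | (_ ∷ T) , linked , refl , end = proj₁ (Linked⇒Star T linked end)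

  oppositeOp : ∀ v → ∃[ u ] op u ≢ op v
  oppositeOp v with op v | hasIns v | hasDel v
  ... | ins | _               | u , _ , opu≡del = u , λ opu≡ins → ins≢del (trans (sym opu≡ins) opu≡del)
  ... | del | u , _ , opu≡ins | _               = u , λ opu≡del → ins≢del (trans (sym opu≡ins) opu≡del)

  neighbour : ∀ v → ∃[ w ] Edge v w
  neighbour v with oppositeOp v
  ... | u , opu≢opv with path v u
  ...   | ε     = contradiction refl opu≢opv
  ...   | e ◅ _ = _ , e

  -- A trail omits its start, so the detour v → w → v is what puts v on it.
  tourThrough : ∀ v u → Σ (Path v v) λ c → u ∈ₗ trail c
  tourThrough v u with neighbour v
  ... | w , e = e ◅ Edge-sym e ◅ (p ◅◅ q) ,
                there (subst (λ T → u ∈ₗ v ∷ T) (sym (trail-◅◅ p q)) (∈-++⁺ˡ (end∈trail p)))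
    where
    p = path v u
    q = path u v

  tourThroughAll : ∀ v (us : List (Fin n)) → Σ (Path v v) λ c → us ⊆ₗ trail c
  tourThroughAll v []       = ε , λ ()
  tourThroughAll v (u ∷ us) with tourThrough v u | tourThroughAll v us
  ... | c , u∈c | d , us⊆d = c ◅◅ d , λ where
      (here refl)   → subst (u ∈ₗ_) (sym (trail-◅◅ c d)) (xs⊆xs++ys _ _ u∈c)
      (there u′∈us) → subst (_ ∈ₗ_) (sym (trail-◅◅ c d)) (xs⊆ys++xs _ (trail c) (us⊆d u′∈us))

  spanningTour : ∀ v → Σ (Path v v) λ c → ∀ u → u ∈ₗ trail c
  spanningTour v = map₂ (λ all⊆c u → all⊆c (∈-allFin u)) (tourThroughAll v (allFin n))

  Refers : Fin m → Fin n → Set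
  Refers x w = elem w ≡ x

  ∈-step-self : ∀ w Y → elem w ∈ step w Y ⇔ op w ≡ ins
  ∈-step-self w Y with op w
  ... | ins = mk⇔ (λ _ → refl) (λ _ → q⊆p∪q Y _ (x∈⁅x⁆ (elem w)))
  ... | del = mk⇔ (λ w∈ → contradiction w∈ (x∉p-x Y (elem w))) (λ ())

  ∈-step-other : ∀ w Y {x} → elem w ≢ x → x ∈ step w Y ⇔ x ∈ Y
  ∈-step-other w Y w∤x with op w
  ... | ins = mk⇔ ([ id , (λ x∈w → contradiction x∈w (x≢y⇒x∉⁅y⁆ (w∤x ∘ sym))) ]′ ∘ x∈p∪q⁻ Y _)
                  (p⊆p∪q _)
  ... | del = mk⇔ (p─q⊆p Y _) (λ x∈Y → x∈p∧x≢y⇒x∈p-y x∈Y (w∤x ∘ sym))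

  step-SubU : ∀ w {Y} → SubU Y → SubU (step w Y)
  step-SubU w {Y} Y⊆U x x∈ with elem w ≟ x
  ... | yes w∣x = w , w∣x
  ... | no  w∤x = Y⊆U x (to (∈-step-other w Y w∤x) x∈)

  run : Subset m → List (Fin n) → Subset m
  run = foldl (flip step)

  ∈-run-unreferenced : ∀ {x} B Y → All (λ w → elem w ≢ x) B → x ∈ run Y B ⇔ x ∈ Y
  ∈-run-unreferenced []      Y []               = mk⇔ id id
  ∈-run-unreferenced (w ∷ B) Y (w∤x ∷ B-skips) =
    ∈-step-other w Y w∤x ⇔-∘ ∈-run-unreferenced B (step w Y) B-skips

  ∈-run-LastRefIs : ∀ {T x o} Y → LastRefIs T x o → x ∈ run Y T ⇔ o ≡ ins
  ∈-run-LastRefIs Y (A , u , B , refl , refl , refl , B-skips)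
    rewrite foldl-++ (flip step) Y A (u ∷ B) =
    ∈-step-self u (run Y A) ⇔-∘ ∈-run-unreferenced B (step u (run Y A)) B-skips

  LastRefIs-∷⁺ : ∀ {T x o} w → LastRefIs T x o → LastRefIs (w ∷ T) x o
  LastRefIs-∷⁺ w (A , u , B , refl , u∣x , opu , B-skips) = w ∷ A , u , B , refl , u∣x , opu , B-skips

  LastRefIs-∷⁻ : ∀ {T x o} w → Any (Refers x) T → LastRefIs (w ∷ T) x o → LastRefIs T x o
  LastRefIs-∷⁻ w refs ([]    , _ , _ , refl , _ , _ , B-skips) = contradiction refs (All¬⇒¬Any B-skips)
  LastRefIs-∷⁻ w refs (_ ∷ A , u , B , refl , u∣x , opu , B-skips) = A , u , B , refl , u∣x , opu , B-skips

  LastRefIs-∷⇔ : ∀ {T x o} w → Any (Refers x) T → LastRefIs T x o ⇔ LastRefIs (w ∷ T) x o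
  LastRefIs-∷⇔ w refs = mk⇔ (LastRefIs-∷⁺ w) (LastRefIs-∷⁻ w refs)

  lastRef : ∀ {x} T → Any (Refers x) T → ∃[ o ] LastRefIs T x o
  lastRef {x} (w ∷ T) refs with any? (λ u → elem u ≟ x) T
  ... | yes refsT = map₂ (LastRefIs-∷⁺ w) (lastRef T refsT)
  ... | no ¬refsT with refs
  ...   | here w∣x    = op w , [] , w , T , refl , w∣x , refl , ¬Any⇒All¬ T ¬refsT
  ...   | there refsT = contradiction refsT ¬refsT

  ∈-run-lastIns : ∀ {T x} Y → LastRefIs T x ins → x ∈ run Y T
  ∈-run-lastIns Y lastIns = from (∈-run-LastRefIs Y lastIns) refl

  ∉-run-lastDel : ∀ {T x} Y → LastRefIs T x del → x ∉ run Y T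
  ∉-run-lastDel Y lastDel = ins≢del ∘ sym ∘ to (∈-run-LastRefIs Y lastDel)

  LastRefsAgree : Subset m → List (Fin n) → Fin m → Set
  LastRefsAgree X W x = (x ∈ X ⇔ LastRefIs W x ins) × (x ∉ X ⇔ LastRefIs W x del)

  LastRefsAgree-∷ : ∀ {X T x} w → Any (Refers x) T → LastRefsAgree X T x → LastRefsAgree X (w ∷ T) x
  LastRefsAgree-∷ w refs (∈⇔ , ∉⇔) = LastRefIs-∷⇔ w refs ⇔-∘ ∈⇔ , LastRefIs-∷⇔ w refs ⇔-∘ ∉⇔

  run-LastRefsAgree : ∀ {T x} Y → Any (Refers x) T → LastRefsAgree (run Y T) T x
  run-LastRefsAgree {T} Y refs with lastRef T refs
  ... | ins , lastIns =
        mk⇔ (λ _ → lastIns) (λ _ → x∈)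
      , mk⇔ (contradiction x∈) (∉-run-lastDel Y)
    where x∈ = ∈-run-lastIns Y lastIns
  ... | del , lastDel =
        mk⇔ (λ x∈ → contradiction x∈ x∉) (λ lastIns → contradiction (∈-run-lastIns Y lastIns) x∉)
      , mk⇔ (λ _ → lastDel) (λ _ → x∉)
    where x∉ = ∉-run-lastDel Y lastDel

  SubU-ext : ∀ {X Y} → SubU X → SubU Y → (∀ x → InU x → x ∈ X ⇔ x ∈ Y) → X ≡ Y
  SubU-ext X⊆U Y⊆U agree =
    ⊆-antisym (λ x∈X → to (agree _ (X⊆U _ x∈X)) x∈X) (λ x∈Y → from (agree _ (Y⊆U _ x∈Y)) x∈Y)

  reach-of-path : ∀ {u v Y} (p : Path u v) → SubU Y → Reach (u , Y) (v , run Y (trail p))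
  reach-of-path ε                 Y⊆U = ε
  reach-of-path (_◅_ {j = w} e p) Y⊆U = (Y⊆U , wY⊆U , e , refl) ◅ reach-of-path p wY⊆U
    where wY⊆U = step-SubU w Y⊆U

  path-of-reach : ∀ {u v Y Z} → Reach (u , Y) (v , Z) → Σ (Path u v) λ p → Z ≡ run Y (trail p)
  path-of-reach ε = ε , refl
  path-of-reach (_◅_ {j = _ , _} (_ , _ , e , refl) r) with path-of-reach r
  ... | p , refl = e ◅ p , refl

  run-◅◅ : ∀ {u v w} Y (p : Path u v) (q : Path v w) →
           run Y (trail (p ◅◅ q)) ≡ run (run Y (trail p)) (trail q)
  run-◅◅ Y p q rewrite trail-◅◅ p q = foldl-++ (flip step) Y (trail p) (trail q)

  sink-reach-closed : ∀ {C} → IsSinkComponent C → ∀ {p q} → Reach p q → C p → C q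
  sink-reach-closed (_ , _ , _ , _ , closed) = Star-preserves λ {p} {q} e p∈C → closed p q p∈C e

  inSink⇒goodClosedWalk : ∀ {C} → IsSinkComponent C → ∀ v X → SubU X → C (v , X) →
                          ∃[ W ] GoodClosedWalk v X W
  inSink⇒goodClosedWalk {C} sink@(_ , _ , strong , _ , _) v X X⊆U vX∈C =
    v ∷ T , (proj₁ walk , refl , proj₂ walk) , (λ x → there ∘ covers x) , agree
    where
    c = proj₁ (spanningTour v)
    vY∈C : C (v , run X (trail c))
    vY∈C = sink-reach-closed sink (reach-of-path c X⊆U) vX∈C
    back = path-of-reach (strong _ _ vY∈C vX∈C)
    T = trail (c ◅◅ proj₁ back)
    walk = Star⇒Linked (c ◅◅ proj₁ back)
    X≡runT : X ≡ run X T
    X≡runT = trans (proj₂ back) (sym (run-◅◅ X c (proj₁ back)))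
    covers : ∀ x → InU x → Any (Refers x) T
    covers x (u , u∣x) =
      Any.map (λ { refl → u∣x })
              (subst (u ∈ₗ_) (sym (trail-◅◅ c (proj₁ back))) (xs⊆xs++ys _ _ (proj₂ (spanningTour v) u)))
    agree : ∀ x → InU x → LastRefsAgree X (v ∷ T) x
    agree x U∋x = subst (λ Z → LastRefsAgree Z (v ∷ T) x) (sym X≡runT)
                        (LastRefsAgree-∷ v (covers x U∋x) (run-LastRefsAgree X (covers x U∋x)))

  goodClosedWalk⇒inSink : ∀ {C} → IsSinkComponent C → ∀ v X → SubU X →
                          ∃[ W ] GoodClosedWalk v X W → C (v , X)
  goodClosedWalk⇒inSink {C} sink@(valid , ((u , Y) , uY∈C) , _ , _ , _) v X X⊆U
    (_ ∷ T , (linked , refl , end) , covers , agree) with Linked⇒Star T linked end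
  ... | p , refl = subst (λ Z → C (v , Z)) (sym X≡R) vR∈C
    where
    w = proj₁ (neighbour v)
    q : Path u v
    q = path u w ◅◅ (Edge-sym (proj₂ (neighbour v)) ◅ p)
    vR∈C : C (v , run Y (trail q))
    vR∈C = sink-reach-closed sink (reach-of-path q (valid _ uY∈C)) uY∈C
    R-agree : ∀ x → InU x → LastRefsAgree (run Y (trail q)) (v ∷ trail p) x
    R-agree x U∋x = subst (λ Z → LastRefsAgree Z (v ∷ trail p) x) (sym (run-◅◅ Y (path u w) _))
                          (run-LastRefsAgree _ (covers x U∋x))
    X≡R : X ≡ run Y (trail q)
    X≡R = SubU-ext X⊆U (valid _ vR∈C) λ x U∋x → ⇔-sym (proj₁ (R-agree x U∋x)) ⇔-∘ proj₁ (agree x U∋x)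

lemma3 : ∀ {n m} (G : EventGraph n m) → let open EG G in
    (C : DNode → Set) → IsSinkComponent C → ReachableFromAllEmpty C →
    (v : Fin n) (X : Subset m) → SubU X →
    (C (v , X) ⇔ (∃[ W ] GoodClosedWalk v X W))
lemma3 G C sink _ v X X⊆U =
  mk⇔ (inSink⇒goodClosedWalk G sink v X X⊆U) (goodClosedWalk⇒inSink G sink v X X⊆U)
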